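{- Assume the law of excluded middle. Then for all $\alpha,\beta\in\mathrm{ord}$, we have $\alpha\le\beta$ or $\beta<\alpha$. Moreover, if $\beta<\alpha$, there exists $i\in\mathrm{In}_\alpha$ such that $\beta\le\alpha_i$.
   Context: Let $\mathfrak F$ be a set of index sets containing $\mathbb N$ and every $\mathbb N_k=\{n\in\mathbb N:n<k\}$, closed (up to isomorphism) under finitely enumerated subsets, sets of finitely enumerated subsets, and disjoint unions indexed by elements of $\mathfrak F$. The set $\mathrm{ord}=\mathrm{ord}_{\mathfrak F}$ is defined inductively: a distinguished element $\underline 0$, and for every $I\in\mathfrak F$ and family $(\alpha_i)_{i\in I}$ in $\mathrm{ord}$ an element $\mathrm S(\alpha_i)_{i\in I}$. For $\alpha=\mathrm S(\alpha_i)_{i\in I}$, $\mathrm{In}_\alpha=I$; by convention $\mathrm{In}_{\underline0}=\emptyset$. For a finite list $F\subseteq_f\mathrm{In}_\alpha$, $\alpha_F$ is the list of the $\alpha_i$, $i\in F$. By simultaneous induction ($m\ge1$): $\alpha\le\beta^1,\dots,\beta^m$ means $\alpha_i<\beta^1,\dots,\beta^m$ for all $i\in\mathrm{In}_\alpha$; $\alpha<\beta^1,\dots,\beta^m$ means there exist finite lists $F_k\subseteq_f\mathrm{In}_{\beta^k}$, not all empty, with $\alpha\le\beta^1_{F_1},\dots,\beta^m_{F_m}$. The case $m=1$ gives the binary relations $\le$ and $<$. -}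

module Defs where

open import Data.Nat using (ℕ)
open import Data.Fin using (Fin)
open import Data.Empty using (⊥)
open import Data.Unit using (⊤)
open import Data.List using (List; []; _∷_; map; _++_)
open import Data.List.Relation.Unary.All using (All; []; _∷_)
open import Data.List.Relation.Unary.Any using (Any)
open import Data.Sum using (_⊎_)
open import Data.Product using (Σ; _×_; _,_)
open import Relation.Binary.PropositionalEquality using (_≢_)
open import Function.Bundles using (_↔_)

-- A family 𝔉 of index sets, given as a universe of codes U with decoding El.
-- It contains ℕ and every ℕ_k = Fin k (up to isomorphism).
-- (The further closure properties of 𝔉 are not needed for the statement and
--  are omitted; the theorem is stated for every such family.)
record IndexFamily : Set₁ where
  field
    U    : Set
    El   : U → Set
    nat  : U
    natIso : El nat ↔ ℕ
    fin  : ℕ → U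
    finIso : (k : ℕ) → El (fin k) ↔ Fin k

module _ (𝔉 : IndexFamily) where
  open IndexFamily 𝔉

  data Ord : Set where
    𝟘 : Ord
    S : (I : U) → (El I → Ord) → Ord

  In : Ord → Set
  In 𝟘 = ⊥
  In (S I f) = El I

  comp : (α : Ord) → In α → Ord
  comp 𝟘 ()
  comp (S I f) i = f i

  compL : (α : Ord) → List (In α) → List Ord
  compL α F = map (comp α) F

  Choice : List Ord → Set
  Choice βs = All (λ β → List (In β)) βs

  applyChoice : (βs : List Ord) → Choice βs → List Ord
  applyChoice [] [] = []
  applyChoice (β ∷ βs) (F ∷ Fs) = compL β F ++ applyChoice βs Fs

  NotAllEmpty : {βs : List Ord} → Choice βs → Set
  NotAllEmpty [] = ⊥
  NotAllEmpty (F ∷ Fs) = (F ≢ []) ⊎ NotAllEmpty Fs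

  _≤*_ : Ord → List Ord → Set
  _<*_ : Ord → List Ord → Set
  𝟘 ≤* βs = ⊤   -- vacuous: In 𝟘 is empty
  S I f ≤* βs = (i : El I) → f i <* βs
  α <* βs = Σ (Choice βs) λ Fs → NotAllEmpty Fs × (α ≤* applyChoice βs Fs)

  _≤_ : Ord → Ord → Set
  α ≤ β = α ≤* (β ∷ [])

  _<_ : Ord → Ord → Set
  α < β = α <* (β ∷ [])

{-# OPTIONS --safe #-}
module Submission where

open import Defs
open import Level using (0ℓ)
open import Data.Sum using (_⊎_; inj₁; inj₂; [_,_]′)
open import Data.Product using (Σ; _×_; _,_)
open import Axiom.ExcludedMiddle using (ExcludedMiddle)
open import Data.Unit using (⊤; tt)
open import Data.Empty using (⊥-elim)
open import Data.List using (List; []; _∷_)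
open import Data.List.Membership.Propositional using (_∈_; lose)
open import Data.List.Relation.Unary.All as All using (All; []; _∷_)
open import Data.List.Relation.Unary.Any using (Any; here; there; satisfied)
open import Data.List.Relation.Unary.Any.Properties using (++⁻; map⁻; singleton⁻)
open import Relation.Nullary using (yes; no)
open import Relation.Binary.PropositionalEquality using (_≢_; refl)

-- The relations ≤ and < against lists of ordinals are compared
-- with the plain binary relations ⊑ and ⊏ defined by recursion on the left
-- argument, in which "x ⊏ y" means "x ⊑ y_k for a single child y_k".  The
-- relation ⊑ is a preorder, and by excluded middle every x, y satisfy
-- x ⊑ y or y ⊏ x; hence every nonempty list of ordinals has a ⊑-greatest
-- element.  Using these maxima, x < β¹,…,βᵐ yields x ⊏ βᵏ for one k, while
-- x ⊏ y trivially yields x < y (choose the single index k).  The theorem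
-- is totality of ⊑, ⊏ transported along this comparison.

module _ (𝔉 : IndexFamily) where
  open IndexFamily 𝔉 using (El)

  private
    Ordinal = Ord 𝔉

  infix 4 _⊑_ _⊏_

  _⊑_ : Ordinal → Ordinal → Set
  _⊏_ : Ordinal → Ordinal → Set
  𝟘 ⊑ y = ⊤
  S I f ⊑ y = (i : El I) → f i ⊏ y
  x ⊏ y = Σ (In 𝔉 y) λ k → x ⊑ comp 𝔉 y k

  ⊑-refl : (x : Ordinal) → x ⊑ x
  ⊑-refl 𝟘 = tt
  ⊑-refl (S I f) i = i , ⊑-refl (f i)

  ⊑-trans : {x y z : Ordinal} → x ⊑ y → y ⊑ z → x ⊑ z
  ⊏-⊑-trans : {x y z : Ordinal} → x ⊏ y → y ⊑ z → x ⊏ z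
  ⊑-trans {𝟘} _ _ = tt
  ⊑-trans {S I f} x⊑y y⊑z i = ⊏-⊑-trans (x⊑y i) y⊑z
  ⊏-⊑-trans {y = S J g} (k , x⊑gk) y⊑z with y⊑z k
  ... | m , gk⊑zm = m , ⊑-trans x⊑gk gk⊑zm

  ⊏⇒⊑ : {x y : Ordinal} → x ⊏ y → x ⊑ y
  ⊏⇒⊑ {𝟘} _ = tt
  ⊏⇒⊑ {S I f} (k , x⊑yk) i = k , ⊏⇒⊑ (x⊑yk i)

  ⊑⇒≤ : {x y : Ordinal} → x ⊑ y → _≤_ 𝔉 x y
  ⊏⇒< : {x y : Ordinal} → x ⊏ y → _<_ 𝔉 x y
  ⊑⇒≤ {𝟘} _ = tt
  ⊑⇒≤ {S I f} x⊑y i = ⊏⇒< (x⊑y i)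
  ⊏⇒< (k , x⊑yk) = (k ∷ []) ∷ [] , inj₁ (λ ()) , ⊑⇒≤ x⊑yk

  applyChoice-nonempty : {βs : List Ordinal} (Fs : Choice 𝔉 βs) →
                         NotAllEmpty 𝔉 Fs → applyChoice 𝔉 βs Fs ≢ []
  applyChoice-nonempty ([] ∷ Fs) (inj₁ []≢[]) = ⊥-elim ([]≢[] refl)
  applyChoice-nonempty ([] ∷ Fs) (inj₂ ne) = applyChoice-nonempty Fs ne
  applyChoice-nonempty ((k ∷ F) ∷ Fs) _ = λ ()

  Any-applyChoice⁻ : {P : Ordinal → Set} (βs : List Ordinal) (Fs : Choice 𝔉 βs) →
                     Any P (applyChoice 𝔉 βs Fs) →
                     Any (λ β → Σ (In 𝔉 β) λ k → P (comp 𝔉 β k)) βs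
  Any-applyChoice⁻ (β ∷ βs) (F ∷ Fs) p with ++⁻ (compL 𝔉 β F) p
  ... | inj₁ q = here (satisfied (map⁻ q))
  ... | inj₂ q = there (Any-applyChoice⁻ βs Fs q)

  module _ (lem : ExcludedMiddle 0ℓ) where

    ⊑-total : (x y : Ordinal) → x ⊑ y ⊎ y ⊏ x
    ⊑-total 𝟘 y = inj₁ tt
    ⊑-total (S I f) y with lem {y ⊏ S I f}
    ... | yes y⊏x = inj₂ y⊏x
    ... | no y⋢x = inj₁ λ i → [ (λ y⊑fi → ⊥-elim (y⋢x (i , y⊑fi))) , (λ fi⊏y → fi⊏y) ]′
                                (⊑-total y (f i))

    ⊑-maximum : (xs : List Ordinal) → xs ≢ [] → Σ Ordinal λ m → m ∈ xs × All (_⊑ m) xs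
    ⊑-maximum [] []≢[] = ⊥-elim ([]≢[] refl)
    ⊑-maximum (x ∷ []) _ = x , here refl , ⊑-refl x ∷ []
    ⊑-maximum (x ∷ y ∷ ys) _ with ⊑-maximum (y ∷ ys) (λ ())
    ... | m , m∈ , ys⊑m with ⊑-total x m
    ...   | inj₁ x⊑m = m , there m∈ , x⊑m ∷ ys⊑m
    ...   | inj₂ m⊏x = x , here refl , ⊑-refl x ∷ All.map (λ z⊑m → ⊑-trans z⊑m (⊏⇒⊑ m⊏x)) ys⊑m

    ≤*⇒⊑ : {x m : Ordinal} {γs : List Ordinal} → All (_⊑ m) γs → _≤*_ 𝔉 x γs → x ⊑ m
    <*⇒⊏ : {x : Ordinal} {βs : List Ordinal} → _<*_ 𝔉 x βs → Any (x ⊏_) βs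
    ≤*⇒⊑ {𝟘} _ _ = tt
    ≤*⇒⊑ {S I f} γs⊑m x≤γs i =
      All.lookupWith (λ γ⊑m fi⊏γ → ⊏-⊑-trans fi⊏γ γ⊑m) γs⊑m (<*⇒⊏ (x≤γs i))
    <*⇒⊏ {βs = βs} (Fs , ne , x≤γs) with ⊑-maximum (applyChoice 𝔉 βs Fs) (applyChoice-nonempty Fs ne)
    ... | m , m∈ , γs⊑m = Any-applyChoice⁻ βs Fs (lose m∈ (≤*⇒⊑ γs⊑m x≤γs))

proposition3p19 : (𝔉 : IndexFamily) → ExcludedMiddle 0ℓ →
    (α β : Ord 𝔉) →
      (_≤_ 𝔉 α β ⊎ _<_ 𝔉 β α)
      × (_<_ 𝔉 β α → Σ (In 𝔉 α) (λ i → _≤_ 𝔉 β (comp 𝔉 α i)))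
proposition3p19 𝔉 lem α β = trichotomy , child-above
  where
  trichotomy : _≤_ 𝔉 α β ⊎ _<_ 𝔉 β α
  trichotomy with ⊑-total 𝔉 lem α β
  ... | inj₁ α⊑β = inj₁ (⊑⇒≤ 𝔉 α⊑β)
  ... | inj₂ β⊏α = inj₂ (⊏⇒< 𝔉 β⊏α)

  child-above : _<_ 𝔉 β α → Σ (In 𝔉 α) (λ i → _≤_ 𝔉 β (comp 𝔉 α i))
  child-above β<α with singleton⁻ (<*⇒⊏ 𝔉 lem β<α)
  ... | i , β⊑αi = i , ⊑⇒≤ 𝔉 β⊑αi
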